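{- Let $S[1..n]$ be a string with a string attractor $\Gamma$ of size $\gamma$, with $n/\gamma$ a power of $2$, and consider the $\Gamma$-tree of $S$ described in the context. Then any substring $S[i..j]$ of length at least $2$ either overlaps two consecutive leaf blocks of the $\Gamma$-tree (i.e., contains the last position of one leaf block and the first position of the next one) or is completely contained inside an unmarked explicit block.
   Context: A string attractor of $S[1..n]$ is a set of positions $\Gamma$ such that every substring $S[i..j]$ has an occurrence $S[i'..j']=S[i..j]$ with $[i',j']$ containing some element of $\Gamma$. The $\Gamma$-tree: at level $l=0$, $S$ is split into $\gamma$ consecutive blocks of length $b_0=n/\gamma$; at each level $l$, blocks have length $b_l=n/(\gamma 2^l)$, and levels go down to $l=\log_2(n/\gamma)$ where blocks have length $1$. The distance between a position $j$ and a block $S[a..a']$ is $a-j$ if $a>j$, $j-a'$ if $a'<j$, and $0$ otherwise. At each level $l$, a block is marked if it is at distance $<b_l$ from some position of $\Gamma$, and unmarked otherwise. The explicit blocks are all blocks of level $0$ together with, for each level $l\ge0$, the two halves (blocks of level $l+1$) of each marked explicit block of level $l$. The leaf blocks are the explicit blocks that are either unmarked, or marked at the last level (length $1$); they partition $S$ into consecutive blocks. -}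

module Defs where

open import Data.Nat using (ℕ; zero; suc; _+_; _*_; _∸_; _^_; _≤_; _<_; _<ᵇ_)
open import Data.Bool using (if_then_else_)
open import Data.Fin using (Fin; toℕ)
open import Data.List using (List; length)
open import Data.List.Membership.Propositional using (_∈_)
open import Data.List.Relation.Unary.All using (All)
open import Data.List.Relation.Unary.Unique.Propositional using (Unique)
open import Data.Product using (Σ; ∃; _×_)
open import Data.Sum using (_⊎_)
open import Relation.Nullary using (¬_)
open import Relation.Binary.PropositionalEquality using (_≡_)

-- Positions are 0-indexed: S[0..n-1], S : Fin n → A.

SameSub : {A : Set} {n : ℕ} → (Fin n → A) → ℕ → ℕ → ℕ → Set
SameSub {n = n} S i i' m =
  ∀ (d : ℕ) → d < m → (p q : Fin n) → toℕ p ≡ i + d → toℕ q ≡ i' + d → S p ≡ S q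

IsAttractor : {A : Set} {n : ℕ} → (Fin n → A) → List ℕ → Set
IsAttractor {n = n} S Γ =
  All (_< n) Γ ×
  (∀ i j → i ≤ j → j < n →
     Σ ℕ λ i' → Σ ℕ λ j' → (j' < n) × (j' ∸ i' ≡ j ∸ i) × (i' ≤ j') ×
       SameSub S i i' (suc (j ∸ i)) ×
       Σ ℕ λ g → (g ∈ Γ) × (i' ≤ g) × (g ≤ j'))

-- Γ-tree with n = γ · 2^k.  Level l ∈ [0,k]; block length b_l = 2^(k-l);
-- block t of level l (0 ≤ t < γ·2^l) is S[t·b_l .. (t+1)·b_l - 1].
blen : (k l : ℕ) → ℕ
blen k l = 2 ^ (k ∸ l)

bstart : (k l t : ℕ) → ℕ
bstart k l t = t * blen k l

bend : (k l t : ℕ) → ℕ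
bend k l t = suc t * blen k l ∸ 1

dist : (j a a' : ℕ) → ℕ
dist j a a' = if j <ᵇ a then a ∸ j else (if a' <ᵇ j then j ∸ a' else 0)

Marked : (Γ : List ℕ) (k l t : ℕ) → Set
Marked Γ k l t = ∃ λ g → (g ∈ Γ) × (dist g (bstart k l t) (bend k l t) < blen k l)

data Explicit (Γ : List ℕ) (γ k : ℕ) : ℕ → ℕ → Set where
  top   : ∀ {t} → t < γ → Explicit Γ γ k 0 t
  child : ∀ {l t c} → Explicit Γ γ k l t → Marked Γ k l t → l < k → c < 2 →
          Explicit Γ γ k (suc l) (2 * t + c)

Leaf : (Γ : List ℕ) (γ k l t : ℕ) → Set
Leaf Γ γ k l t = Explicit Γ γ k l t × (¬ Marked Γ k l t ⊎ l ≡ k)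

module Submission where

-- The proof is a descent through the tree.  The level-0 block containing i
-- either also contains j, or S[i..j] crosses its right end.  Inside an
-- explicit block containing S[i..j] we stop if the block is unmarked; a
-- marked block of the last level has length 1 and cannot contain two
-- positions; a marked block above the last level has two explicit halves,
-- and S[i..j] lies in one of them (descend) or crosses their common
-- boundary.  A crossing of the boundary between two adjacent explicit
-- blocks is turned into a crossing between two leaves by following the
-- rightmost leaf below the left block and the leftmost leaf below the right
-- one, which end resp. start at the same positions.

open import Defs
open import Data.Nat using (ℕ; zero; suc; _+_; _*_; _∸_; _^_; _≤_; _<_; pred; _≤?_; _<?_; _/_; _%_; s≤s; z<s; s<s; NonZero)
open import Data.Nat.Properties
open import Data.Nat.DivMod using (m/n*n≤m; m≡m%n+[m/n]*n; m%n<n)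
open import Data.Nat.Tactic.RingSolver using (solve-∀)
open import Data.Fin using (Fin)
open import Data.List using (List; length)
open import Data.List.Membership.Propositional using (find; lose)
open import Data.List.Relation.Unary.Any using (any?)
open import Data.List.Relation.Unary.Unique.Propositional using (Unique)
open import Data.Product using (Σ; _×_; _,_)
open import Data.Sum using (_⊎_; inj₁; inj₂)
open import Data.Empty using (⊥-elim)
open import Relation.Nullary using (¬_; Dec; yes; no)
open import Relation.Nullary.Decidable using (map′)
open import Relation.Binary.PropositionalEquality using (_≡_; refl; sym; trans; cong; subst; module ≡-Reasoning)

block-adjacent : ∀ k l t → suc (bend k l t) ≡ bstart k l (suc t)
block-adjacent k l t = begin
  suc (suc t * blen k l ∸ 1)    ≡⟨ cong suc (pred[m∸n]≡m∸[1+n] (suc t * blen k l) 0) ⟨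
  suc (pred (suc t * blen k l)) ≡⟨ suc-pred (suc t * blen k l) {{m*n≢0 (suc t) (blen k l) {{_}} {{m^n≢0 2 (k ∸ l)}}}} ⟩
  suc t * blen k l              ∎
  where open ≡-Reasoning

last-level-point : ∀ k t → bend k k t ≡ bstart k k t
last-level-point k t rewrite n∸n≡0 k = refl

blen-halves : ∀ {k l} → l < k → blen k l ≡ 2 * blen k (suc l)
blen-halves l<k = cong (2 ^_) (+-∸-assoc 1 l<k)

double-index : ∀ t b → (2 * t + 0) * b ≡ t * (2 * b)
double-index = solve-∀

double-next-index : ∀ t b → suc (2 * t + 1) * b ≡ suc t * (2 * b)
double-next-index = solve-∀

left-half-start : ∀ {k l} t → l < k → bstart k (suc l) (2 * t + 0) ≡ bstart k l t
left-half-start {k} {l} t l<k = begin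
  (2 * t + 0) * blen k (suc l) ≡⟨ double-index t (blen k (suc l)) ⟩
  t * (2 * blen k (suc l))     ≡⟨ cong (t *_) (blen-halves l<k) ⟨
  t * blen k l                 ∎
  where open ≡-Reasoning

right-half-end : ∀ {k l} t → l < k → bend k (suc l) (2 * t + 1) ≡ bend k l t
right-half-end {k} {l} t l<k = cong (_∸ 1) (begin
  suc (2 * t + 1) * blen k (suc l) ≡⟨ double-next-index t (blen k (suc l)) ⟩
  suc t * (2 * blen k (suc l))     ≡⟨ cong (suc t *_) (blen-halves l<k) ⟨
  suc t * blen k l                 ∎)
  where open ≡-Reasoning

halves-adjacent : ∀ k l t → suc (bend k l (2 * t + 0)) ≡ bstart k l (2 * t + 1)
halves-adjacent k l t =
  trans (block-adjacent k l (2 * t + 0)) (cong (bstart k l) (sym (+-suc (2 * t) 0)))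

before-boundary : ∀ {e s x} → suc e ≡ s → x < s → x ≤ e
before-boundary refl (s≤s x≤e) = x≤e

after-boundary : ∀ {e s x} → suc e ≡ s → e < x → s ≤ x
after-boundary refl e<x = e<x

within-block : ∀ i b .{{_ : NonZero b}} → (i / b) * b ≤ i × i < suc (i / b) * b
within-block i b = m/n*n≤m i b , (begin-strict
  i                 ≡⟨ m≡m%n+[m/n]*n i b ⟩
  i % b + i / b * b <⟨ +-monoˡ-< (i / b * b) (m%n<n i b) ⟩
  b + i / b * b     ∎)
  where open ≤-Reasoning

top-index : ℕ → ℕ → ℕ
top-index k i = _/_ i (2 ^ k) {{m^n≢0 2 k}}

top-index-contains : ∀ k i →
  bstart k 0 (top-index k i) ≤ i × i < bstart k 0 (suc (top-index k i))
top-index-contains k i = within-block i (2 ^ k) {{m^n≢0 2 k}}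

below-last : ∀ {k l m} → l + suc m ≡ k → l < k
below-last {l = l} eq = <-≤-trans (m<m+n l z<s) (≤-reflexive eq)

next-level : ∀ {k l m} → l + suc m ≡ k → suc l + m ≡ k
next-level {l = l} {m} eq = trans (sym (+-suc l m)) eq

module GammaTree (Γ : List ℕ) (γ k : ℕ) where

  marked? : ∀ l t → Dec (Marked Γ k l t)
  marked? l t = map′ find (λ (_ , g∈Γ , near) → lose g∈Γ near)
    (any? (λ g → dist g (bstart k l t) (bend k l t) <? blen k l) Γ)

  left-half : ∀ {l t} → Explicit Γ γ k l t → Marked Γ k l t → l < k →
    Explicit Γ γ k (suc l) (2 * t + 0)
  left-half e mk l<k = child e mk l<k z<s

  right-half : ∀ {l t} → Explicit Γ γ k l t → Marked Γ k l t → l < k →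
    Explicit Γ γ k (suc l) (2 * t + 1)
  right-half e mk l<k = child e mk l<k (s<s z<s)

  rightmost-leaf : ∀ m l t → l + m ≡ k → Explicit Γ γ k l t →
    Σ ℕ λ l' → Σ ℕ λ t' → Leaf Γ γ k l' t' × (bend k l' t' ≡ bend k l t)
  rightmost-leaf m l t height e with marked? l t
  ... | no unmarked = l , t , (e , inj₁ unmarked) , refl
  rightmost-leaf zero l t height e | yes _ =
    l , t , (e , inj₂ (trans (sym (+-identityʳ l)) height)) , refl
  rightmost-leaf (suc m) l t height e | yes mk
    with rightmost-leaf m (suc l) (2 * t + 1) (next-level height)
           (right-half e mk (below-last height))
  ... | l' , t' , leaf , same-end =
    l' , t' , leaf , trans same-end (right-half-end t (below-last height))

  leftmost-leaf : ∀ m l t → l + m ≡ k → Explicit Γ γ k l t →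
    Σ ℕ λ l' → Σ ℕ λ t' → Leaf Γ γ k l' t' × (bstart k l' t' ≡ bstart k l t)
  leftmost-leaf m l t height e with marked? l t
  ... | no unmarked = l , t , (e , inj₁ unmarked) , refl
  leftmost-leaf zero l t height e | yes _ =
    l , t , (e , inj₂ (trans (sym (+-identityʳ l)) height)) , refl
  leftmost-leaf (suc m) l t height e | yes mk
    with leftmost-leaf m (suc l) (2 * t + 0) (next-level height)
           (left-half e mk (below-last height))
  ... | l' , t' , leaf , same-start =
    l' , t' , leaf , trans same-start (left-half-start t (below-last height))

  Conclusion : ℕ → ℕ → Set
  Conclusion i j =
    (Σ ℕ λ l₁ → Σ ℕ λ t₁ → Σ ℕ λ l₂ → Σ ℕ λ t₂ →
       Leaf Γ γ k l₁ t₁ × Leaf Γ γ k l₂ t₂ ×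
       (suc (bend k l₁ t₁) ≡ bstart k l₂ t₂) ×
       (i ≤ bend k l₁ t₁) × (bstart k l₂ t₂ ≤ j))
    ⊎
    (Σ ℕ λ l → Σ ℕ λ t → Explicit Γ γ k l t × ¬ Marked Γ k l t ×
       (bstart k l t ≤ i) × (j ≤ bend k l t))

  crosses : ∀ {i j} m l t m' l' t' → l + m ≡ k → Explicit Γ γ k l t →
    l' + m' ≡ k → Explicit Γ γ k l' t' → suc (bend k l t) ≡ bstart k l' t' →
    i ≤ bend k l t → bstart k l' t' ≤ j → Conclusion i j
  crosses {i} {j} m l t m' l' t' height e height' e' adjacent i≤end start≤j
    with rightmost-leaf m l t height e | leftmost-leaf m' l' t' height' e'
  ... | l₁ , t₁ , leaf₁ , same-end | l₂ , t₂ , leaf₂ , same-start =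
    inj₁ (l₁ , t₁ , l₂ , t₂ , leaf₁ , leaf₂ ,
          trans (cong suc same-end) (trans adjacent (sym same-start)) ,
          subst (i ≤_) (sym same-end) i≤end ,
          subst (_≤ j) (sym same-start) start≤j)

  descend : ∀ {i j} m l t → l + m ≡ k → Explicit Γ γ k l t →
    bstart k l t ≤ i → j ≤ bend k l t → i < j → Conclusion i j
  descend m l t height e start≤i j≤end i<j with marked? l t
  ... | no unmarked = inj₂ (l , t , e , unmarked , start≤i , j≤end)
  descend zero l t height e start≤i j≤end i<j | yes _ =
    ⊥-elim (<⇒≱ i<j (≤-trans j≤end (≤-trans (≤-reflexive point) start≤i)))
    where
    point : bend k l t ≡ bstart k l t
    point rewrite trans (sym (+-identityʳ l)) height = last-level-point k t
  descend {i} {j} (suc m) l t height e start≤i j≤end i<j | yes mk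
    with j ≤? bend k (suc l) (2 * t + 0) | i <? bstart k (suc l) (2 * t + 1)
  ... | yes j-in-left | _ =
    descend m (suc l) (2 * t + 0) (next-level height) (left-half e mk l<k)
      (subst (_≤ i) (sym (left-half-start t l<k)) start≤i) j-in-left i<j
    where
    l<k : l < k
    l<k = below-last height
  ... | no j-past-left | yes i-before-right =
    crosses m (suc l) (2 * t + 0) m (suc l) (2 * t + 1)
      (next-level height) (left-half e mk l<k)
      (next-level height) (right-half e mk l<k)
      (halves-adjacent k (suc l) t)
      (before-boundary (halves-adjacent k (suc l) t) i-before-right)
      (after-boundary (halves-adjacent k (suc l) t) (≰⇒> j-past-left))
    where
    l<k : l < k
    l<k = below-last height
  ... | no _ | no i-in-right =
    descend m (suc l) (2 * t + 1) (next-level height) (right-half e mk l<k)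
      (≮⇒≥ i-in-right) (subst (j ≤_) (sym (right-half-end t l<k)) j≤end) i<j
    where
    l<k : l < k
    l<k = below-last height

  top-block : ∀ {n t} → n ≡ γ * 2 ^ k → bstart k 0 t < n → Explicit Γ γ k 0 t
  top-block {t = t} refl start<n = top (*-cancelʳ-< (2 ^ k) t γ start<n)

open GammaTree using (top-block; descend; crosses)

lemma2 : {A : Set} (n γ k : ℕ) (S : Fin n → A) (Γ : List ℕ) →
    Unique Γ → length Γ ≡ γ → IsAttractor S Γ → n ≡ γ * 2 ^ k →
    (i j : ℕ) → i < j → j < n →
    (Σ ℕ λ l₁ → Σ ℕ λ t₁ → Σ ℕ λ l₂ → Σ ℕ λ t₂ →
       Leaf Γ γ k l₁ t₁ × Leaf Γ γ k l₂ t₂ ×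
       (suc (bend k l₁ t₁) ≡ bstart k l₂ t₂) ×
       (i ≤ bend k l₁ t₁) × (bstart k l₂ t₂ ≤ j))
    ⊎
    (Σ ℕ λ l → Σ ℕ λ t → Explicit Γ γ k l t × ¬ Marked Γ k l t ×
       (bstart k l t ≤ i) × (j ≤ bend k l t))
lemma2 n γ k S Γ _ _ _ n≡γ2ᵏ i j i<j j<n
  with top-index-contains k i | j <? bstart k 0 (suc (top-index k i))
... | start≤i , i<next | yes j<next =
  descend Γ γ k k 0 t refl (top-block Γ γ k n≡γ2ᵏ (≤-<-trans start≤i (<-trans i<j j<n)))
    start≤i (before-boundary (block-adjacent k 0 t) j<next) i<j
  where
  t : ℕ
  t = top-index k i
... | start≤i , i<next | no j≮next =
  crosses Γ γ k k 0 t k 0 (suc t) refl (top-block Γ γ k n≡γ2ᵏ (<-trans start<next next<n))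
    refl (top-block Γ γ k n≡γ2ᵏ next<n) (block-adjacent k 0 t)
    (before-boundary (block-adjacent k 0 t) i<next) (≮⇒≥ j≮next)
  where
  t : ℕ
  t = top-index k i
  next<n : bstart k 0 (suc t) < n
  next<n = ≤-<-trans (≮⇒≥ j≮next) j<n
  start<next : bstart k 0 t < bstart k 0 (suc t)
  start<next = ≤-<-trans start≤i i<next
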